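{- Let $N,p,q\in\mathbb{N}$ with $p+q\le N$, put $t\coloneqq N-p-q$, let $\lambda$ be an integer partition of length at most $N$, let $A$ be an $N\times t$ matrix, and let $u=(u_1,\ldots,u_p)$, $v=(v_1,\ldots,v_q)$ with $u_j\ne v_k$ for all $j\in\{1,\ldots,p\}$, $k\in\{1,\ldots,q\}$. Let $D$ be the determinant of the $N\times N$ matrix with columns (in this order) \[ A,\ \operatorname{H}^N_{t+1,\lambda}(u_1,\ldots,u_p,v),\ \operatorname{H}^N_{t+2,\lambda}(u_2,\ldots,u_p,v),\ \ldots,\ \operatorname{H}^N_{t+p,\lambda}(u_p,v),\ \operatorname{H}^N_{t+p+1,\lambda}(v_1,\ldots,v_q),\ \operatorname{H}^N_{t+p+2,\lambda}(v_2,\ldots,v_q),\ \ldots,\ \operatorname{H}^N_{t+p+q,\lambda}(v_q), \] where $(u_k,\ldots,u_p,v)$ stands for $(u_k,\ldots,u_p,v_1,\ldots,v_q)$. Let $D_1$ be the determinant of the matrix with columns \[ A,\ \operatorname{H}^N_{t+q+1,\lambda}(u_1,\ldots,u_p),\ \operatorname{H}^N_{t+q+2,\lambda}(u_2,\ldots,u_p),\ \ldots,\ \operatorname{H}^N_{t+p+q,\lambda}(u_p),\ \operatorname{H}^N_{t+p+1,\lambda}(v_1,\ldots,v_q),\ \ldots,\ \operatorname{H}^N_{t+p+q,\lambda}(v_q), \] and $D_2$ the determinant of the matrix with columns \[ A,\ \operatorname{H}^N_{t+p+q,\lambda}(u_p),\ \ldots,\ \operatorname{H}^N_{t+q+2,\lambda}(u_2,\ldots,u_p),\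 \operatorname{H}^N_{t+q+1,\lambda}(u_1,\ldots,u_p),\ \operatorname{H}^N_{t+p+1,\lambda}(v_1,\ldots,v_q),\ \ldots,\ \operatorname{H}^N_{t+p+q,\lambda}(v_q). \] Then \[ D=\frac{D_1}{\prod_{j=1}^p\prod_{k=1}^q(u_j-v_k)}=\frac{D_2}{(-1)^{p(p-1)/2}\prod_{j=1}^p\prod_{k=1}^q(u_j-v_k)}. \]
   Context: For $s\in\mathbb{Z}$, a partition $\lambda$ of length at most $N$ (with $\lambda_j\coloneqq0$ beyond its length), and numbers or variables $t_1,\ldots,t_m$, $\operatorname{H}^N_{s,\lambda}(t_1,\ldots,t_m)$ denotes the column vector $\bigl[\operatorname{h}_{s+\lambda_j-j}(t_1,\ldots,t_m)\bigr]_{j=1}^N$, where $\operatorname{h}_d$ is the complete homogeneous symmetric polynomial of degree $d$ ($\operatorname{h}_0=1$, $\operatorname{h}_d=0$ for $d<0$). The entries of $A$ and the $u_j,v_k$ lie in a common field (or are variables, the identity then being in the field of rational functions). -}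

module Defs where

open import Level using (Level; _⊔_) renaming (suc to lsuc)
open import Algebra.Bundles using (CommutativeRing)
open import Data.Nat as ℕ using (ℕ; zero; suc; _∸_; _<?_)
open import Data.Integer as ℤ using (ℤ; +_; -[1+_])
open import Data.Fin as Fin using (Fin; toℕ; fromℕ<; punchIn)
open import Data.List using (List; []; _∷_; drop; _++_)
open import Data.Vec.Functional using (toList)
open import Data.Product using (Σ)
open import Relation.Nullary using (¬_; yes; no)

record Field (c ℓ : Level) : Set (lsuc (c ⊔ ℓ)) where
  field
    commutativeRing : CommutativeRing c ℓ
  open CommutativeRing commutativeRing
  field
    1≉0 : ¬ (1# ≈ 0#)
    inverse : ∀ x → ¬ (x ≈ 0#) → Σ Carrier (λ y → x * y ≈ 1#)

-- A partition of length at most N, given by its first N parts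
-- (λ_1 ≥ λ_2 ≥ … ≥ λ_N ≥ 0; parts beyond N are 0).
IsPartition : ∀ {N} → (Fin N → ℕ) → Set
IsPartition {N} la = ∀ (i j : Fin N) → i Fin.≤ j → la j ℕ.≤ la i

module Ops {c ℓ : Level} (R : CommutativeRing c ℓ) where
  open CommutativeRing R

  Σᶠ : ∀ n → (Fin n → Carrier) → Carrier
  Σᶠ zero f = 0#
  Σᶠ (suc n) f = f Fin.zero + Σᶠ n (λ i → f (Fin.suc i))

  Πᶠ : ∀ n → (Fin n → Carrier) → Carrier
  Πᶠ zero f = 1#
  Πᶠ (suc n) f = f Fin.zero * Πᶠ n (λ i → f (Fin.suc i))

  sgn : ℕ → Carrier
  sgn zero = 1#
  sgn (suc k) = - sgn k

  -- determinant (Laplace expansion along the first column);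
  -- a matrix is M : Fin n → Fin n → Carrier, M i j = entry in row i, column j
  det : ∀ n → (Fin n → Fin n → Carrier) → Carrier
  det zero M = 1#
  det (suc n) M =
    Σᶠ (suc n) (λ i → sgn (toℕ i) * (M i Fin.zero *
      det n (λ r s → M (punchIn i r) (Fin.suc s))))

  -- complete homogeneous symmetric polynomial h_d(x_1,…,x_m), d ∈ ℕ
  hℕ : ℕ → List Carrier → Carrier
  hℕ zero xs = 1#
  hℕ (suc d) [] = 0#
  hℕ (suc d) (x ∷ xs) = hℕ (suc d) xs + x * hℕ d (x ∷ xs)

  h : ℤ → List Carrier → Carrier
  h (+ d) xs = hℕ d xs
  h -[1+ d ] xs = 0#

  -- H^N_{s,λ}(xs) : the column vector [h_{s+λ_j-j}(xs)]_{j=1..N}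
  -- (row index j : Fin N stands for j+1)
  H : ∀ {N} → ℤ → (Fin N → ℕ) → List Carrier → Fin N → Carrier
  H s la xs j = h (s ℤ.+ + la j ℤ.- + suc (toℕ j)) xs

  blockMat : ∀ N t p → (Fin N → Fin t → Carrier) →
             (ℕ → Fin N → Carrier) → (ℕ → Fin N → Carrier) →
             Fin N → Fin N → Carrier
  blockMat N t p A uc vc i c with toℕ c <? t
  ... | yes c<t = A i (fromℕ< c<t)
  ... | no _ with (toℕ c ∸ t) <? p
  ...   | yes _ = uc (toℕ c ∸ t) i
  ...   | no _ = vc (toℕ c ∸ t ∸ p) i

  module Lemma7p2 (N p q : ℕ) (la : Fin N → ℕ)
                  (u : Fin p → Carrier) (v : Fin q → Carrier) where
    t : ℕ
    t = N ∸ p ∸ q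

    us vs : List Carrier
    us = toList u
    vs = toList v

    -- m-th u-column (m = k-1, k = 1..p) of D : H_{t+k,λ}(u_k,…,u_p,v_1,…,v_q)
    uColD : ℕ → Fin N → Carrier
    uColD m = H (+ (t ℕ.+ suc m)) la (drop m us ++ vs)

    -- m-th u-column of D₁ : H_{t+q+k,λ}(u_k,…,u_p)
    uColD₁ : ℕ → Fin N → Carrier
    uColD₁ m = H (+ (t ℕ.+ q ℕ.+ suc m)) la (drop m us)

    -- m-th u-column of D₂ (reversed order) : H_{t+q+k,λ}(u_k,…,u_p), k = p - m
    uColD₂ : ℕ → Fin N → Carrier
    uColD₂ m = H (+ (t ℕ.+ q ℕ.+ (p ∸ m))) la (drop (p ∸ suc m) us)

    -- r-th v-column (r = k-1, k = 1..q) : H_{t+p+k,λ}(v_k,…,v_q)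
    vCol : ℕ → Fin N → Carrier
    vCol r = H (+ (t ℕ.+ p ℕ.+ suc r)) la (drop r vs)

    D D₁ D₂ : (Fin N → Fin t → Carrier) → Carrier
    D A = det N (blockMat N t p A uColD vCol)
    D₁ A = det N (blockMat N t p A uColD₁ vCol)
    D₂ A = det N (blockMat N t p A uColD₂ vCol)

    P : Carrier
    P = Πᶠ p (λ j → Πᶠ q (λ k → u j - v k))

{-# OPTIONS --safe #-}
-- Since h_{d+1}(x, Z, Y) = (x − y) h_d(x, Z, y, Y) + h_{d+1}(Z, y, Y), deleting v₁
-- from the variable lists of the u-columns of D replaces the k-th u-column by
-- (u_k − v₁) times itself plus its right neighbour, the last one gaining the first
-- v-column. Done from left to right, these are column operations that multiply the
-- determinant by ∏_k (u_k − v₁); deleting v₁, …, v_q in turn transforms D·P into D₁.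
-- D₂ is D₁ with its p u-columns reversed, which costs the sign (−1)^{p(p−1)/2}.
module Submission where

open import Defs
open import Level using (Level)
open import Algebra.Bundles using (CommutativeRing)
open import Data.Empty using (⊥-elim)
open import Data.Fin as Fin using (Fin; toℕ; punchIn; opposite; inject₁; fromℕ; fromℕ<)
open import Data.Fin.Properties using (toℕ<n; toℕ-injective; toℕ-fromℕ<; toℕ-fromℕ; toℕ-inject₁; opposite-prop)
open import Data.Integer as ℤ using (+_; -[1+_])
import Data.Integer.Properties as ℤₚ
open import Data.List using (List; []; _∷_; _++_; drop)
open import Data.List.Properties using (++-identityʳ)
open import Data.Nat as ℕ using (ℕ; zero; suc; _∸_; _≤_; _<_; z≤n; s≤s)
import Data.Nat.Properties as ℕₚ
open import Data.Nat.DivMod using (m*n/n≡m)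
open import Data.Product using (Σ-syntax; _×_; _,_)
open import Data.Sum using (_⊎_; inj₁; inj₂)
open import Data.Vec.Functional using (toList)
open import Function using (_∘_)
open import Relation.Binary.PropositionalEquality as ≡ using (_≡_; _≢_)
open import Relation.Nullary using (¬_; Dec; yes; no)

triangular : ℕ → ℕ
triangular zero    = 0
triangular (suc p) = p ℕ.+ triangular p

suc[p]*p≡triangular*2 : ∀ p → suc p ℕ.* p ≡ triangular (suc p) ℕ.* 2
suc[p]*p≡triangular*2 zero    = ≡.refl
suc[p]*p≡triangular*2 (suc p) = begin
  suc (suc p) ℕ.* suc p                   ≡⟨ ℕₚ.*-comm (2 ℕ.+ p) (suc p) ⟩
  suc p ℕ.* (2 ℕ.+ p)                     ≡⟨ ℕₚ.*-distribˡ-+ (suc p) 2 p ⟩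
  suc p ℕ.* 2 ℕ.+ suc p ℕ.* p             ≡⟨ ≡.cong (suc p ℕ.* 2 ℕ.+_) (suc[p]*p≡triangular*2 p) ⟩
  suc p ℕ.* 2 ℕ.+ triangular (suc p) ℕ.* 2 ≡⟨ ℕₚ.*-distribʳ-+ 2 (suc p) (triangular (suc p)) ⟨
  triangular (suc (suc p)) ℕ.* 2          ∎
  where open ≡.≡-Reasoning

p*[p∸1]/2≡triangular : ∀ p → (p ℕ.* (p ∸ 1)) ℕ./ 2 ≡ triangular p
p*[p∸1]/2≡triangular zero    = ≡.refl
p*[p∸1]/2≡triangular (suc p) =
  ≡.trans (≡.cong (ℕ._/ 2) (suc[p]*p≡triangular*2 p)) (m*n/n≡m (triangular (suc p)) 2)

toℕ-opposite-fromℕ : ∀ p → toℕ (opposite (fromℕ p)) ≡ 0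
toℕ-opposite-fromℕ p =
  ≡.trans (opposite-prop (fromℕ p)) (≡.trans (≡.cong (p ∸_) (toℕ-fromℕ p)) (ℕₚ.n∸n≡0 p))

toℕ-opposite-inject₁ : ∀ {p} (k : Fin p) → toℕ (opposite (inject₁ k)) ≡ suc (toℕ (opposite k))
toℕ-opposite-inject₁ {p} k = begin
  toℕ (opposite (inject₁ k))  ≡⟨ opposite-prop (inject₁ k) ⟩
  p ∸ toℕ (inject₁ k)         ≡⟨ ≡.cong (p ∸_) (toℕ-inject₁ k) ⟩
  p ∸ toℕ k                   ≡⟨ ℕₚ.+-∸-assoc 1 (toℕ<n k) ⟩
  suc (p ∸ suc (toℕ k))       ≡⟨ ≡.cong suc (opposite-prop k) ⟨
  suc (toℕ (opposite k))      ∎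
  where open ≡.≡-Reasoning

N∸p∸q+p+q≡N : ∀ N p q → p ℕ.+ q ≤ N → N ∸ p ∸ q ℕ.+ p ℕ.+ q ≡ N
N∸p∸q+p+q≡N N p q p+q≤N = ≡.trans (ℕₚ.+-assoc (N ∸ p ∸ q) p q)
  (≡.trans (≡.cong (ℕ._+ (p ℕ.+ q)) (ℕₚ.∸-+-assoc N p q)) (ℕₚ.m∸n+n≡m p+q≤N))

m+1+n+o≡m+n+1+o : ∀ m n o → m ℕ.+ suc n ℕ.+ o ≡ m ℕ.+ n ℕ.+ suc o
m+1+n+o≡m+n+1+o m n o = ≡.trans (≡.cong (ℕ._+ o) (ℕₚ.+-suc m n)) (≡.sym (ℕₚ.+-suc (m ℕ.+ n) o))

m+n+o∸m≡n+o : ∀ m n o → m ℕ.+ n ℕ.+ o ∸ m ≡ n ℕ.+ o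
m+n+o∸m≡n+o m n o = ≡.trans (≡.cong (_∸ m) (ℕₚ.+-assoc m n o)) (ℕₚ.m+n∸m≡n m (n ℕ.+ o))

+[1+d]+l-j≡suc[+d+l-j] : ∀ d l j → + suc d ℤ.+ + l ℤ.- + j ≡ ℤ.suc (+ d ℤ.+ + l ℤ.- + j)
+[1+d]+l-j≡suc[+d+l-j] d l j = ≡.trans (≡.cong (ℤ._- + j) (ℤₚ.+-assoc (+ 1) (+ d) (+ l)))
                                        (ℤₚ.+-assoc (+ 1) (+ d ℤ.+ + l) (ℤ.- + j))

drop-toList : ∀ {a} {A : Set a} {p} (u : Fin p → A) (k : Fin p) →
              drop (toℕ k) (toList u) ≡ u k ∷ drop (suc (toℕ k)) (toList u)
drop-toList u Fin.zero    = ≡.refl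
drop-toList u (Fin.suc k) = drop-toList (u ∘ Fin.suc) k

drop-toList-all : ∀ {a} {A : Set a} p (u : Fin p → A) → drop p (toList u) ≡ []
drop-toList-all zero    u = ≡.refl
drop-toList-all (suc p) u = drop-toList-all p (u ∘ Fin.suc)

Outside : ℕ → ℕ → ℕ → Set
Outside t p c = c < t ⊎ t ℕ.+ p ≤ c

data Position (t p c : ℕ) : Set where
  before : c < t → Position t p c
  inside : (k : Fin p) → c ≡ t ℕ.+ toℕ k → Position t p c
  after  : t ℕ.+ p ≤ c → Position t p c

position : ∀ t p c → Position t p c
position t p c with c ℕ.<? t
... | yes c<t = before c<t
... | no c≮t with c ∸ t ℕ.<? p
...   | yes c∸t<p = inside (fromℕ< c∸t<p)
          (≡.trans (≡.sym (ℕₚ.m+[n∸m]≡n (ℕₚ.≮⇒≥ c≮t))) (≡.cong (t ℕ.+_) (≡.sym (toℕ-fromℕ< c∸t<p))))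
...   | no c∸t≮p = after
          (≡.subst (t ℕ.+ p ≤_) (ℕₚ.m+[n∸m]≡n (ℕₚ.≮⇒≥ c≮t)) (ℕₚ.+-monoʳ-≤ t (ℕₚ.≮⇒≥ c∸t≮p)))

inside⇒¬Outside : ∀ t p (k : Fin p) → ¬ Outside t p (t ℕ.+ toℕ k)
inside⇒¬Outside t p k (inj₁ t+k<t) = ℕₚ.m+n≮m t (toℕ k) t+k<t
inside⇒¬Outside t p k (inj₂ t+p≤t+k) = ℕₚ.<⇒≱ (toℕ<n k) (ℕₚ.+-cancelˡ-≤ t _ _ t+p≤t+k)

Outside-empty : ∀ t c → Outside t 0 c
Outside-empty t c with c ℕ.<? t
... | yes c<t = inj₁ c<t
... | no c≮t = inj₂ (≡.subst (_≤ c) (≡.sym (ℕₚ.+-identityʳ t)) (ℕₚ.≮⇒≥ c≮t))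

Outside-shrink : ∀ t p c → Outside t (suc p) c → Outside (suc t) p c
Outside-shrink t p c (inj₁ c<t) = inj₁ (ℕₚ.m<n⇒m<1+n c<t)
Outside-shrink t p c (inj₂ t+1+p≤c) = inj₂ (≡.subst (_≤ c) (ℕₚ.+-suc t p) t+1+p≤c)

Outside-grow : ∀ t p c → c ≢ t → Outside (suc t) p c → Outside t (suc p) c
Outside-grow t p c c≢t (inj₁ c<1+t) = inj₁ (ℕₚ.≤∧≢⇒< (ℕₚ.≤-pred c<1+t) c≢t)
Outside-grow t p c c≢t (inj₂ 1+t+p≤c) = inj₂ (≡.subst (_≤ c) (≡.sym (ℕₚ.+-suc t p)) 1+t+p≤c)

-- Determinants as functions of their columns

module _ {c ℓ : Level} (R : CommutativeRing c ℓ) where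
  open CommutativeRing R hiding (zero)
  open Ops R
  open import Algebra.Properties.Ring ring
    using (-‿distribˡ-*; -‿distribʳ-*; -‿involutive; -‿+-comm; -0#≈0#; +-cancelʳ; +-inverseʳ-unique)
  open import Algebra.Properties.Semiring.Sum semiring
    using (sum; sum-cong-≋; sum-replicate-zero; ∑-distrib-+; *-distribˡ-sum)
  open import Algebra.Properties.CommutativeMonoid.Sum *-commutativeMonoid
    using () renaming (sum to product; sum-cong-≋ to product-cong-≋; ∑-comm to ∏-comm)
  open import Data.Vec.Functional.Relation.Binary.Equality.Setoid setoid
    using (_≋_; ≋-reflexive; ≋-sym; ≋-trans)
  open import Relation.Binary.Reasoning.Setoid setoid
  open import Algebra.Solver.Ring.NaturalCoefficients.Default commutativeSemiring
    using (solve; _:=_; _:+_; _:*_)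

  Σᶠ≡sum : ∀ n (f : Fin n → Carrier) → Σᶠ n f ≡ sum f
  Σᶠ≡sum zero    f = ≡.refl
  Σᶠ≡sum (suc n) f = ≡.cong (_+_ (f Fin.zero)) (Σᶠ≡sum n (f ∘ Fin.suc))

  Πᶠ≡product : ∀ n (f : Fin n → Carrier) → Πᶠ n f ≡ product f
  Πᶠ≡product zero    f = ≡.refl
  Πᶠ≡product (suc n) f = ≡.cong (_*_ (f Fin.zero)) (Πᶠ≡product n (f ∘ Fin.suc))

  Σᶠ-cong : ∀ n {f g : Fin n → Carrier} → f ≋ g → Σᶠ n f ≈ Σᶠ n g
  Σᶠ-cong n {f} {g} f≋g rewrite Σᶠ≡sum n f | Σᶠ≡sum n g = sum-cong-≋ f≋g

  Σᶠ-zero : ∀ n {f : Fin n → Carrier} → (∀ i → f i ≈ 0#) → Σᶠ n f ≈ 0#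
  Σᶠ-zero n {f} f≈0 rewrite Σᶠ≡sum n f = trans (sum-cong-≋ f≈0) (sum-replicate-zero n)

  Σᶠ-distrib-+ : ∀ n (f g : Fin n → Carrier) → Σᶠ n (λ i → f i + g i) ≈ Σᶠ n f + Σᶠ n g
  Σᶠ-distrib-+ n f g rewrite Σᶠ≡sum n (λ i → f i + g i) | Σᶠ≡sum n f | Σᶠ≡sum n g = ∑-distrib-+ f g

  *-distribˡ-Σᶠ : ∀ n x (f : Fin n → Carrier) → x * Σᶠ n f ≈ Σᶠ n (λ i → x * f i)
  *-distribˡ-Σᶠ n x f rewrite Σᶠ≡sum n f | Σᶠ≡sum n (λ i → x * f i) = *-distribˡ-sum x f

  -‿distrib-Σᶠ : ∀ n (f : Fin n → Carrier) → - Σᶠ n f ≈ Σᶠ n (λ i → - f i)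
  -‿distrib-Σᶠ zero    f = -0#≈0#
  -‿distrib-Σᶠ (suc n) f = trans (sym (-‿+-comm _ _)) (+-congˡ (-‿distrib-Σᶠ n (f ∘ Fin.suc)))

  Πᶠ-comm : ∀ m n (f : Fin m → Fin n → Carrier) →
            Πᶠ m (λ i → Πᶠ n (f i)) ≈ Πᶠ n (λ j → Πᶠ m (λ i → f i j))
  Πᶠ-comm m n f = begin
    Πᶠ m (λ i → Πᶠ n (f i))               ≡⟨ Πᶠ≡product m (λ i → Πᶠ n (f i)) ⟩
    product (λ i → Πᶠ n (f i))            ≈⟨ product-cong-≋ (λ i → reflexive (Πᶠ≡product n (f i))) ⟩
    product (λ i → product (f i))         ≈⟨ ∏-comm f ⟩
    product (λ j → product (λ i → f i j)) ≈⟨ product-cong-≋ (λ j → reflexive (≡.sym (Πᶠ≡product m (λ i → f i j)))) ⟩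
    product (λ j → Πᶠ m (λ i → f i j))    ≡⟨ Πᶠ≡product n (λ j → Πᶠ m (λ i → f i j)) ⟨
    Πᶠ n (λ j → Πᶠ m (λ i → f i j))       ∎

  sgn-+ : ∀ m n → sgn (m ℕ.+ n) ≈ sgn m * sgn n
  sgn-+ zero    n = sym (*-identityˡ _)
  sgn-+ (suc m) n = trans (-‿cong (sgn-+ m n)) (-‿distribˡ-* _ _)

  -x≈0⇒x≈0 : ∀ {x} → - x ≈ 0# → x ≈ 0#
  -x≈0⇒x≈0 {x} -x≈0 = trans (sym (-‿involutive x)) (trans (-‿cong -x≈0) -0#≈0#)

  Col : ℕ → Set c
  Col n = Fin n → Carrier

  -- Columns are indexed by ℕ to avoid Fin arithmetic; only the columns k < n are read.
  Cols : ℕ → Set c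
  Cols n = ℕ → Col n

  infixl 7 _·ᶜ_
  infixl 6 _+ᶜ_

  _·ᶜ_ : ∀ {n} → Carrier → Col n → Col n
  (a ·ᶜ X) i = a * X i

  _+ᶜ_ : ∀ {n} → Col n → Col n → Col n
  (X +ᶜ Y) i = X i + Y i

  ≋-col : ∀ {n} (F : Cols n) {a b} → a ≡ b → F a ≋ F b
  ≋-col F a≡b = ≋-reflexive (≡.cong F a≡b)

  detᶜ : ∀ n → Cols n → Carrier
  detᶜ n F = det n (λ i j → F (toℕ j) i)

  minor : ∀ {n} → Fin (suc n) → Cols (suc n) → Cols n
  minor i F k r = F (suc k) (punchIn i r)

  laplaceTerm : ∀ {n} → Cols (suc n) → Fin (suc n) → Carrier
  laplaceTerm {n} F i = sgn (toℕ i) * (F 0 i * detᶜ n (minor i F))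

  det-cong : ∀ n {M M′ : Fin n → Fin n → Carrier} → (∀ i j → M i j ≈ M′ i j) → det n M ≈ det n M′
  det-cong zero    M≈M′ = refl
  det-cong (suc n) M≈M′ = Σᶠ-cong (suc n) λ i →
    *-congˡ {sgn (toℕ i)} (*-cong (M≈M′ i Fin.zero) (det-cong n λ r s → M≈M′ (punchIn i r) (Fin.suc s)))

  detᶜ-cong : ∀ n {F G : Cols n} → (∀ k → k < n → F k ≋ G k) → detᶜ n F ≈ detᶜ n G
  detᶜ-cong n F≋G = det-cong n λ i j → F≋G (toℕ j) (toℕ<n j) i

  detᶜ-linear : ∀ n j → j < n → ∀ a (F G K : Cols n) →
                F j ≋ a ·ᶜ G j +ᶜ K j →
                (∀ k → k ≢ j → F k ≋ G k) → (∀ k → k ≢ j → F k ≋ K k) →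
                detᶜ n F ≈ a * detᶜ n G + detᶜ n K
  detᶜ-linear (suc n) j j<n a F G K Fj≋ F≋G F≋K = begin
    Σᶠ (suc n) (laplaceTerm F)                                          ≈⟨ Σᶠ-cong (suc n) (term j j<n Fj≋ F≋G F≋K) ⟩
    Σᶠ (suc n) (λ i → a * laplaceTerm G i + laplaceTerm K i)            ≈⟨ Σᶠ-distrib-+ (suc n) (λ i → a * laplaceTerm G i) (laplaceTerm K) ⟩
    Σᶠ (suc n) (λ i → a * laplaceTerm G i) + Σᶠ (suc n) (laplaceTerm K) ≈⟨ +-congʳ (*-distribˡ-Σᶠ (suc n) a (laplaceTerm G)) ⟨
    a * Σᶠ (suc n) (laplaceTerm G) + Σᶠ (suc n) (laplaceTerm K)         ∎
    where
    distrib₁ : ∀ s a g k m → s * ((a * g + k) * m) ≈ a * (s * (g * m)) + s * (k * m)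
    distrib₁ = solve 5 (λ s a g k m → s :* ((a :* g :+ k) :* m) := a :* (s :* (g :* m)) :+ s :* (k :* m)) refl
    distrib₂ : ∀ s f a x y → s * (f * (a * x + y)) ≈ a * (s * (f * x)) + s * (f * y)
    distrib₂ = solve 5 (λ s f a x y → s :* (f :* (a :* x :+ y)) := a :* (s :* (f :* x)) :+ s :* (f :* y)) refl
    term : ∀ j → j < suc n → F j ≋ a ·ᶜ G j +ᶜ K j →
           (∀ k → k ≢ j → F k ≋ G k) → (∀ k → k ≢ j → F k ≋ K k) →
           ∀ i → laplaceTerm F i ≈ a * laplaceTerm G i + laplaceTerm K i
    term zero _ F0≋ F≋G F≋K i = begin
      sgn (toℕ i) * (F 0 i * detᶜ n (minor i F))
        ≈⟨ *-congˡ (*-cong (F0≋ i) (detᶜ-cong n λ k _ r → F≋G (suc k) (λ ()) (punchIn i r))) ⟩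
      sgn (toℕ i) * ((a * G 0 i + K 0 i) * detᶜ n (minor i G))
        ≈⟨ distrib₁ _ _ _ _ _ ⟩
      a * laplaceTerm G i + sgn (toℕ i) * (K 0 i * detᶜ n (minor i G))
        ≈⟨ +-congˡ (*-congˡ (*-congˡ (detᶜ-cong n λ k _ r →
             trans (sym (F≋G (suc k) (λ ()) (punchIn i r))) (F≋K (suc k) (λ ()) (punchIn i r))))) ⟩
      a * laplaceTerm G i + laplaceTerm K i ∎
    term (suc j) (s≤s j<n) Fj≋ F≋G F≋K i = begin
      sgn (toℕ i) * (F 0 i * detᶜ n (minor i F))
        ≈⟨ *-congˡ (*-congˡ (detᶜ-linear n j j<n a (minor i F) (minor i G) (minor i K)
             (λ r → Fj≋ (punchIn i r))
             (λ k k≢j r → F≋G (suc k) (k≢j ∘ ℕₚ.suc-injective) (punchIn i r))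
             (λ k k≢j r → F≋K (suc k) (k≢j ∘ ℕₚ.suc-injective) (punchIn i r)))) ⟩
      sgn (toℕ i) * (F 0 i * (a * detᶜ n (minor i G) + detᶜ n (minor i K)))
        ≈⟨ distrib₂ _ _ _ _ _ ⟩
      a * (sgn (toℕ i) * (F 0 i * detᶜ n (minor i G))) + sgn (toℕ i) * (F 0 i * detᶜ n (minor i K))
        ≈⟨ +-cong (*-congˡ (*-congˡ (*-congʳ (F≋G 0 (λ ()) i)))) (*-congˡ (*-congʳ (F≋K 0 (λ ()) i))) ⟩
      a * laplaceTerm G i + laplaceTerm K i ∎

  detᶜ-additive : ∀ n j → j < n → (F G K : Cols n) →
                  F j ≋ G j +ᶜ K j →
                  (∀ k → k ≢ j → F k ≋ G k) → (∀ k → k ≢ j → F k ≋ K k) →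
                  detᶜ n F ≈ detᶜ n G + detᶜ n K
  detᶜ-additive n j j<n F G K Fj≋ F≋G F≋K =
    trans (detᶜ-linear n j j<n 1# F G K (λ i → trans (Fj≋ i) (+-congʳ (sym (*-identityˡ _)))) F≋G F≋K)
          (+-congʳ (*-identityˡ _))

  -- The Laplace expansion along the first two columns of a matrix whose
  -- first two columns both equal x; Φ σ is the complementary minor on the
  -- rows listed by σ.
  expand₂ : ∀ m → Col (2 ℕ.+ m) → ((Fin m → Fin (2 ℕ.+ m)) → Carrier) → Carrier
  expand₂ m x Φ = Σᶠ (2 ℕ.+ m) λ i → sgn (toℕ i) * (x i *
                    Σᶠ (suc m) λ r → sgn (toℕ r) * (x (punchIn i r) * Φ (punchIn i ∘ punchIn r)))

  -- The terms using row 0 in one of the two columns cancel in pairs.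
  expand₂-peel : ∀ m x Φ → expand₂ m x Φ ≈
    Σᶠ (suc m) λ i → (- sgn (toℕ i)) * (x (Fin.suc i) *
      Σᶠ m λ r → (- sgn (toℕ r)) * (x (Fin.suc (punchIn i r)) * Φ (punchIn (Fin.suc i) ∘ punchIn (Fin.suc r))))
  expand₂-peel m x Φ = begin
    1# * (x₀ * Σᶠ (suc m) g′) + Σᶠ (suc m) (λ i → (- sgn (toℕ i)) * (x (Fin.suc i) * (1# * (x₀ * A i) + rest i)))
      ≈⟨ +-cong (*-identityˡ (x₀ * Σᶠ (suc m) g′)) (Σᶠ-cong (suc m) split) ⟩
    x₀ * Σᶠ (suc m) g′ + Σᶠ (suc m) (λ i → - g i + rem i)
      ≈⟨ +-cong (trans (*-distribˡ-Σᶠ (suc m) x₀ g′) (Σᶠ-cong (suc m) λ i → move x₀ (sgn (toℕ i)) (x (Fin.suc i)) (A i)))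
                (Σᶠ-distrib-+ (suc m) (λ i → - g i) rem) ⟩
    Σᶠ (suc m) g + (Σᶠ (suc m) (λ i → - g i) + Σᶠ (suc m) rem)
      ≈⟨ +-congˡ (+-congʳ (-‿distrib-Σᶠ (suc m) g)) ⟨
    Σᶠ (suc m) g + (- Σᶠ (suc m) g + Σᶠ (suc m) rem)
      ≈⟨ +-assoc _ _ _ ⟨
    Σᶠ (suc m) g - Σᶠ (suc m) g + Σᶠ (suc m) rem
      ≈⟨ +-congʳ (-‿inverseʳ _) ⟩
    0# + Σᶠ (suc m) rem
      ≈⟨ +-identityˡ _ ⟩
    Σᶠ (suc m) rem ∎
    where
    x₀ = x Fin.zero
    A : Fin (suc m) → Carrier
    A i = Φ (Fin.suc ∘ punchIn i)
    rest : Fin (suc m) → Carrier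
    rest i = Σᶠ m λ r → (- sgn (toℕ r)) * (x (Fin.suc (punchIn i r)) * Φ (punchIn (Fin.suc i) ∘ punchIn (Fin.suc r)))
    g′ g rem : Fin (suc m) → Carrier
    g′ i = sgn (toℕ i) * (x (Fin.suc i) * A i)
    g i = sgn (toℕ i) * (x (Fin.suc i) * (x₀ * A i))
    rem i = (- sgn (toℕ i)) * (x (Fin.suc i) * rest i)
    move : ∀ a s y b → a * (s * (y * b)) ≈ s * (y * (a * b))
    move = solve 4 (λ a s y b → a :* (s :* (y :* b)) := s :* (y :* (a :* b))) refl
    split : ∀ i → (- sgn (toℕ i)) * (x (Fin.suc i) * (1# * (x₀ * A i) + rest i)) ≈ - g i + rem i
    split i = begin
      (- sgn (toℕ i)) * (x (Fin.suc i) * (1# * (x₀ * A i) + rest i))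
        ≈⟨ *-congˡ (*-congˡ (+-congʳ (*-identityˡ _))) ⟩
      (- sgn (toℕ i)) * (x (Fin.suc i) * (x₀ * A i + rest i))
        ≈⟨ *-congˡ (distribˡ _ _ _) ⟩
      (- sgn (toℕ i)) * (x (Fin.suc i) * (x₀ * A i) + x (Fin.suc i) * rest i)
        ≈⟨ distribˡ _ _ _ ⟩
      (- sgn (toℕ i)) * (x (Fin.suc i) * (x₀ * A i)) + rem i
        ≈⟨ +-congʳ (-‿distribˡ-* _ _) ⟨
      - g i + rem i ∎

  expand₂-vanishes : ∀ m x Φ → (∀ σ τ → (∀ a → σ a ≡ τ a) → Φ σ ≈ Φ τ) → expand₂ m x Φ ≈ 0#
  expand₂-vanishes zero x Φ Φ-resp = trans (expand₂-peel zero x Φ)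
    (Σᶠ-zero 1 λ i → trans (*-congˡ (zeroʳ (x (Fin.suc i)))) (zeroʳ (- sgn (toℕ i))))
  expand₂-vanishes (suc m) x Φ Φ-resp = begin
    expand₂ (suc m) x Φ
      ≈⟨ expand₂-peel (suc m) x Φ ⟩
    Σᶠ (2 ℕ.+ m) (λ i → (- sgn (toℕ i)) * (x (Fin.suc i) * rest i))
      ≈⟨ Σᶠ-cong (2 ℕ.+ m) (λ i → trans (*-congˡ (*-congˡ (rest≈-inner i))) (neg-neg (sgn (toℕ i)) (x (Fin.suc i)) (inner i))) ⟩
    expand₂ m (x ∘ Fin.suc) (Φ ∘ Fin.lift 1)
      ≈⟨ expand₂-vanishes m (x ∘ Fin.suc) (Φ ∘ Fin.lift 1) lift-resp ⟩
    0# ∎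
    where
    rest inner : Fin (2 ℕ.+ m) → Carrier
    rest i = Σᶠ (suc m) λ r → (- sgn (toℕ r)) * (x (Fin.suc (punchIn i r)) * Φ (punchIn (Fin.suc i) ∘ punchIn (Fin.suc r)))
    inner i = Σᶠ (suc m) λ r → sgn (toℕ r) * (x (Fin.suc (punchIn i r)) * Φ (Fin.lift 1 (punchIn i ∘ punchIn r)))
    lifted : ∀ i r a → (punchIn (Fin.suc i) ∘ punchIn (Fin.suc r)) a ≡ Fin.lift 1 (punchIn i ∘ punchIn r) a
    lifted i r Fin.zero    = ≡.refl
    lifted i r (Fin.suc a) = ≡.refl
    lift-resp : ∀ σ τ → (∀ a → σ a ≡ τ a) → Φ (Fin.lift 1 σ) ≈ Φ (Fin.lift 1 τ)
    lift-resp σ τ σ≗τ = Φ-resp _ _ λ { Fin.zero → ≡.refl ; (Fin.suc a) → ≡.cong Fin.suc (σ≗τ a) }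
    rest≈-inner : ∀ i → rest i ≈ - inner i
    rest≈-inner i = trans
      (Σᶠ-cong (suc m) λ r → trans (*-congˡ { - sgn (toℕ r)} (*-congˡ {x (Fin.suc (punchIn i r))} (Φ-resp _ _ (lifted i r))))
                                     (sym (-‿distribˡ-* (sgn (toℕ r)) _)))
      (sym (-‿distrib-Σᶠ (suc m) λ r → sgn (toℕ r) * (x (Fin.suc (punchIn i r)) * Φ (Fin.lift 1 (punchIn i ∘ punchIn r)))))
    neg-neg : ∀ s y z → (- s) * (y * (- z)) ≈ s * (y * z)
    neg-neg s y z = begin
      (- s) * (y * (- z)) ≈⟨ *-congˡ (-‿distribʳ-* y z) ⟨
      (- s) * (- (y * z)) ≈⟨ -‿distribˡ-* s _ ⟨
      - (s * - (y * z))   ≈⟨ -‿cong (-‿distribʳ-* s _) ⟨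
      - - (s * (y * z))   ≈⟨ -‿involutive _ ⟩
      s * (y * z)         ∎

  detᶜ-adjacent : ∀ n j (F : Cols n) → suc j < n → F j ≋ F (suc j) → detᶜ n F ≈ 0#
  detᶜ-adjacent (suc (suc m)) zero F _ F₀≋F₁ =
    trans (Σᶠ-cong (2 ℕ.+ m) λ i → *-congˡ {sgn (toℕ i)} (*-congˡ {F 0 i} (Σᶠ-cong (suc m) λ r →
             *-congˡ {sgn (toℕ r)} (*-congʳ {Φ (punchIn i ∘ punchIn r)} (sym (F₀≋F₁ (punchIn i r)))))))
          (expand₂-vanishes m (F 0) Φ λ σ τ σ≗τ → detᶜ-cong m λ k _ a → reflexive (≡.cong (F (2 ℕ.+ k)) (σ≗τ a)))
    where
    Φ : (Fin m → Fin (2 ℕ.+ m)) → Carrier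
    Φ σ = detᶜ m (λ k a → F (2 ℕ.+ k) (σ a))
  detᶜ-adjacent (suc n) (suc j) F (s≤s j<n) Fj≋ = Σᶠ-zero (suc n) λ i →
    trans (*-congˡ {sgn (toℕ i)} (*-congˡ {F 0 i} (detᶜ-adjacent n j (minor i F) j<n (λ r → Fj≋ (punchIn i r)))))
          (trans (*-congˡ (zeroʳ _)) (zeroʳ _))

  infixl 5 _[_]≔_
  _[_]≔_ : ∀ {n} → Cols n → ℕ → Col n → Cols n
  (F [ j ]≔ X) k with k ℕ.≟ j
  ... | yes _ = X
  ... | no  _ = F k

  update-≡ : ∀ {n} (F : Cols n) j X → (F [ j ]≔ X) j ≡ X
  update-≡ F j X with j ℕ.≟ j
  ... | yes _   = ≡.refl
  ... | no  j≢j = ⊥-elim (j≢j ≡.refl)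

  update-≢ : ∀ {n} (F : Cols n) {j k} X → k ≢ j → (F [ j ]≔ X) k ≡ F k
  update-≢ F {j} {k} X k≢j with k ℕ.≟ j
  ... | yes k≡j = ⊥-elim (k≢j k≡j)
  ... | no  _   = ≡.refl

  update-comm : ∀ {n} (F : Cols n) {j k} X Y → j ≢ k → ∀ c → (F [ j ]≔ X [ k ]≔ Y) c ≡ (F [ k ]≔ Y [ j ]≔ X) c
  update-comm F {j} {k} X Y j≢k c = by-cases (c ℕ.≟ k)
    where
    by-cases : Dec (c ≡ k) → (F [ j ]≔ X [ k ]≔ Y) c ≡ (F [ k ]≔ Y [ j ]≔ X) c
    by-cases (yes ≡.refl) =
      ≡.trans (update-≡ _ c Y) (≡.sym (≡.trans (update-≢ _ X (j≢k ∘ ≡.sym)) (update-≡ F c Y)))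
    by-cases (no c≢k) = ≡.trans (update-≢ _ Y c≢k) (≡.sym (inner (c ℕ.≟ j)))
      where
      inner : Dec (c ≡ j) → (F [ k ]≔ Y [ j ]≔ X) c ≡ (F [ j ]≔ X) c
      inner (yes ≡.refl) = ≡.trans (update-≡ _ c X) (≡.sym (update-≡ F c X))
      inner (no c≢j) = ≡.trans (update-≢ _ X c≢j) (≡.trans (update-≢ F Y c≢k) (≡.sym (update-≢ F X c≢j)))

  swap : ∀ {n} → ℕ → Cols n → Cols n
  swap j F = F [ j ]≔ F (suc j) [ suc j ]≔ F j

  update-self : ∀ {n} (F : Cols n) j c → (F [ j ]≔ F j) c ≡ F c
  update-self F j c with c ℕ.≟ j
  ... | yes ≡.refl = ≡.refl
  ... | no  _      = ≡.refl

  swap-self : ∀ {n} j (F : Cols n) c → (F [ j ]≔ F j [ suc j ]≔ F (suc j)) c ≡ F c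
  swap-self j F c = by-cases (c ℕ.≟ suc j)
    where
    by-cases : Dec (c ≡ suc j) → (F [ j ]≔ F j [ suc j ]≔ F (suc j)) c ≡ F c
    by-cases (yes ≡.refl) = update-≡ _ c (F c)
    by-cases (no c≢1+j) = ≡.trans (update-≢ _ (F (suc j)) c≢1+j) (update-self F j c)

  swap-≢ : ∀ {n} j (F : Cols n) {c} → c ≢ j → c ≢ suc j → swap j F c ≡ F c
  swap-≢ j F {c} c≢j c≢1+j = ≡.trans (update-≢ _ (F j) c≢1+j) (update-≢ F (F (suc j)) c≢j)

  swap-at : ∀ {n} j (F : Cols n) → swap j F j ≡ F (suc j)
  swap-at j F = ≡.trans (update-≢ _ (F j) (ℕₚ.<⇒≢ (ℕₚ.n<1+n j))) (update-≡ F j (F (suc j)))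

  swap-at-suc : ∀ {n} j (F : Cols n) → swap j F (suc j) ≡ F j
  swap-at-suc j F = update-≡ _ (suc j) (F j)

  detᶜ-update-additive : ∀ n j (F : Cols n) X Y → j < n →
                         detᶜ n (F [ j ]≔ X +ᶜ Y) ≈ detᶜ n (F [ j ]≔ X) + detᶜ n (F [ j ]≔ Y)
  detᶜ-update-additive n j F X Y j<n = detᶜ-additive n j j<n _ _ _
    (≋-reflexive (≡.trans (update-≡ F j _) (≡.cong₂ _+ᶜ_ (≡.sym (update-≡ F j X)) (≡.sym (update-≡ F j Y)))))
    (λ k k≢j → ≋-reflexive (≡.trans (update-≢ F _ k≢j) (≡.sym (update-≢ F X k≢j))))
    (λ k k≢j → ≋-reflexive (≡.trans (update-≢ F _ k≢j) (≡.sym (update-≢ F Y k≢j))))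

  -- Expand d(a + b, a + b) = 0 by additivity in both columns.
  detᶜ-swap : ∀ n j (F : Cols n) → suc j < n → detᶜ n (swap j F) ≈ - detᶜ n F
  detᶜ-swap n j F 1+j<n = +-inverseʳ-unique (detᶜ n F) (detᶜ n (swap j F)) (begin
    detᶜ n F + detᶜ n (swap j F)
      ≈⟨ +-congʳ (detᶜ-cong n λ c _ → ≋-reflexive (≡.sym (swap-self j F c))) ⟩
    d a b + d b a
      ≈⟨ +-cong (+-identityˡ _) (+-identityʳ _) ⟨
    0# + d a b + (d b a + 0#)
      ≈⟨ +-cong (+-congʳ (d-equal a)) (+-congˡ (d-equal b)) ⟨
    d a a + d a b + (d b a + d b b)
      ≈⟨ +-cong (additiveʳ a a b) (additiveʳ b a b) ⟨
    d a (a +ᶜ b) + d b (a +ᶜ b)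
      ≈⟨ additiveˡ a b (a +ᶜ b) ⟨
    d (a +ᶜ b) (a +ᶜ b)
      ≈⟨ d-equal (a +ᶜ b) ⟩
    0# ∎)
    where
    a b : Col n
    a = F j
    b = F (suc j)
    j≢1+j : j ≢ suc j
    j≢1+j = ℕₚ.<⇒≢ (ℕₚ.n<1+n j)
    d : Col n → Col n → Carrier
    d X Y = detᶜ n (F [ j ]≔ X [ suc j ]≔ Y)
    d-equal : ∀ X → d X X ≈ 0#
    d-equal X = detᶜ-adjacent n j (F [ j ]≔ X [ suc j ]≔ X) 1+j<n
      (≋-reflexive (≡.trans (update-≢ (F [ j ]≔ X) X j≢1+j)
                            (≡.trans (update-≡ F j X) (≡.sym (update-≡ (F [ j ]≔ X) (suc j) X)))))
    additiveʳ : ∀ X Y Y′ → d X (Y +ᶜ Y′) ≈ d X Y + d X Y′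
    additiveʳ X Y Y′ = detᶜ-update-additive n (suc j) (F [ j ]≔ X) Y Y′ 1+j<n
    commuted : ∀ X Y → detᶜ n (F [ suc j ]≔ Y [ j ]≔ X) ≈ d X Y
    commuted X Y = detᶜ-cong n λ c _ → ≋-reflexive (≡.sym (update-comm F X Y j≢1+j c))
    additiveˡ : ∀ X X′ Y → d (X +ᶜ X′) Y ≈ d X Y + d X′ Y
    additiveˡ X X′ Y = trans (sym (commuted (X +ᶜ X′) Y))
      (trans (detᶜ-update-additive n j (F [ suc j ]≔ Y) X X′ (ℕₚ.<-trans (ℕₚ.n<1+n j) 1+j<n))
             (+-cong (commuted X Y) (commuted X′ Y)))

  detᶜ-equal : ∀ {n i j} (F : Cols n) → i < j → j < n → F i ≋ F j → detᶜ n F ≈ 0#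
  detᶜ-equal {n} {i} {suc j} F (s≤s i≤j) 1+j<n Fi≋ with ℕₚ.m≤n⇒m<n∨m≡n i≤j
  ... | inj₂ ≡.refl = detᶜ-adjacent n i F 1+j<n Fi≋
  ... | inj₁ i<j = -x≈0⇒x≈0 (trans (sym (detᶜ-swap n j F 1+j<n))
        (detᶜ-equal (swap j F) i<j (ℕₚ.<-trans (ℕₚ.n<1+n j) 1+j<n)
          (≋-trans (≋-reflexive (swap-≢ j F (ℕₚ.<⇒≢ i<j) (ℕₚ.<⇒≢ (ℕₚ.m<n⇒m<1+n i<j))))
                   (≋-trans Fi≋ (≋-reflexive (≡.sym (swap-at j F)))))))

  detᶜ-scale-add : ∀ {n t c} a (F G : Cols n) → t < c → c < n →
                   G t ≋ a ·ᶜ F t +ᶜ F c → (∀ k → k ≢ t → G k ≋ F k) →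
                   detᶜ n G ≈ a * detᶜ n F
  detᶜ-scale-add {n} {t} {c} a F G t<c c<n Gt≋ G≋F = begin
    detᶜ n G                ≈⟨ detᶜ-linear n t (ℕₚ.<-trans t<c c<n) a G F K
                                 (≋-trans Gt≋ λ i → +-congˡ (reflexive (≡.cong (λ X → X i) (≡.sym (update-≡ F t (F c))))))
                                 G≋F (λ k k≢t → ≋-trans (G≋F k k≢t) (≋-reflexive (≡.sym (update-≢ F (F c) k≢t)))) ⟩
    a * detᶜ n F + detᶜ n K ≈⟨ +-congˡ (detᶜ-equal K t<c c<n (≋-reflexive
                                 (≡.trans (update-≡ F t (F c)) (≡.sym (update-≢ F (F c) (ℕₚ.>⇒≢ t<c)))))) ⟩
    a * detᶜ n F + 0#       ≈⟨ +-identityʳ _ ⟩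
    a * detᶜ n F            ∎
    where
    K : Cols n
    K = F [ t ]≔ F c

  splice : ∀ {n} → Cols n → ∀ t p → (Fin p → Col n) → Cols n
  splice F t p W c with position t p c
  ... | before _   = F c
  ... | inside k _ = W k
  ... | after _    = F c

  splice-inside : ∀ {n} (F : Cols n) t p W (k : Fin p) → splice F t p W (t ℕ.+ toℕ k) ≡ W k
  splice-inside F t p W k with position t p (t ℕ.+ toℕ k)
  ... | before t+k<t = ⊥-elim (inside⇒¬Outside t p k (inj₁ t+k<t))
  ... | inside k′ t+k≡t+k′ = ≡.cong W (toℕ-injective (≡.sym (ℕₚ.+-cancelˡ-≡ t _ _ t+k≡t+k′)))
  ... | after t+p≤t+k = ⊥-elim (inside⇒¬Outside t p k (inj₂ t+p≤t+k))

  splice-outside : ∀ {n} (F : Cols n) t p W c → Outside t p c → splice F t p W c ≡ F c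
  splice-outside F t p W c out with position t p c
  ... | before _ = ≡.refl
  ... | inside k ≡.refl = ⊥-elim (inside⇒¬Outside t p k out)
  ... | after _ = ≡.refl

  detᶜ-rotate : ∀ {n} m t (F G : Cols n) → t ℕ.+ m < n →
                G (t ℕ.+ m) ≋ F t →
                (∀ (k : Fin m) → G (t ℕ.+ toℕ k) ≋ F (suc (t ℕ.+ toℕ k))) →
                (∀ c → Outside t (suc m) c → G c ≋ F c) →
                detᶜ n G ≈ sgn m * detᶜ n F
  detᶜ-rotate {n} zero t F G _ G-last _ G-out = trans (detᶜ-cong n G≋F) (sym (*-identityˡ _))
    where
    G≋F : ∀ c → c < n → G c ≋ F c
    G≋F c _ with position t 1 c
    ... | before c<t = G-out c (inj₁ c<t)
    ... | inside Fin.zero ≡.refl = ≋-trans G-last (≋-col F (≡.sym (ℕₚ.+-identityʳ t)))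
    ... | after 1+t≤c = G-out c (inj₂ 1+t≤c)
  detᶜ-rotate {n} (suc m) t F G t+m+1<n G-last G-shift G-out = begin
    detᶜ n G               ≈⟨ detᶜ-rotate m (suc t) (swap t F) G 1+t+m<n last shift out ⟩
    sgn m * detᶜ n (swap t F) ≈⟨ *-congˡ (detᶜ-swap n t F (ℕₚ.≤-<-trans (s≤s (ℕₚ.m≤m+n t m)) 1+t+m<n)) ⟩
    sgn m * - detᶜ n F     ≈⟨ -‿distribʳ-* _ _ ⟨
    - (sgn m * detᶜ n F)   ≈⟨ -‿distribˡ-* _ _ ⟩
    sgn (suc m) * detᶜ n F ∎
    where
    1+t+m<n : suc t ℕ.+ m < n
    1+t+m<n = ≡.subst (_< n) (ℕₚ.+-suc t m) t+m+1<n
    last : G (suc t ℕ.+ m) ≋ swap t F (suc t)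
    last = ≋-trans (≋-col G (≡.sym (ℕₚ.+-suc t m)))
                   (≋-trans G-last (≋-reflexive (≡.sym (swap-at-suc t F))))
    shift : ∀ (k : Fin m) → G (suc t ℕ.+ toℕ k) ≋ swap t F (suc (suc t ℕ.+ toℕ k))
    shift k = ≋-trans (≋-col G (≡.sym (ℕₚ.+-suc t (toℕ k))))
      (≋-trans (G-shift (Fin.suc k))
        (≋-trans (≋-col F (≡.cong suc (ℕₚ.+-suc t (toℕ k))))
          (≋-reflexive (≡.sym (swap-≢ t F (ℕₚ.>⇒≢ (ℕₚ.<-trans (ℕₚ.n<1+n t) (s≤s (s≤s (ℕₚ.m≤m+n t _)))))
                                          (ℕₚ.>⇒≢ (s≤s (s≤s (ℕₚ.m≤m+n t _)))))))))
    out : ∀ c → Outside (suc t) (suc m) c → G c ≋ swap t F c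
    out c (inj₂ 1+t+1+m≤c) =
      ≋-trans (G-out c (inj₂ (≡.subst (_≤ c) (≡.sym (ℕₚ.+-suc t (suc m))) 1+t+1+m≤c)))
              (≋-reflexive (≡.sym (swap-≢ t F (ℕₚ.>⇒≢ c>t) (ℕₚ.>⇒≢ (ℕₚ.<-≤-trans (s≤s (s≤s (ℕₚ.m≤m+n t m)))
                                                                  (≡.subst (_≤ c) (≡.cong suc (ℕₚ.+-suc t m)) 1+t+1+m≤c))))))
      where
      c>t : t < c
      c>t = ℕₚ.<-≤-trans (s≤s (ℕₚ.m≤m+n t (suc m))) 1+t+1+m≤c
    out c (inj₁ c<1+t) with ℕₚ.m≤n⇒m<n∨m≡n (ℕₚ.≤-pred c<1+t)
    ... | inj₂ ≡.refl = ≋-trans (≋-col G (≡.sym (ℕₚ.+-identityʳ c)))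
                          (≋-trans (G-shift Fin.zero)
                            (≋-trans (≋-col F (≡.cong suc (ℕₚ.+-identityʳ c))) (≋-reflexive (≡.sym (swap-at c F)))))
    ... | inj₁ c<t = ≋-trans (G-out c (inj₁ c<t))
                       (≋-reflexive (≡.sym (swap-≢ t F (ℕₚ.<⇒≢ c<t) (ℕₚ.<⇒≢ (ℕₚ.m<n⇒m<1+n c<t)))))

  detᶜ-reverse : ∀ {n} p t (F G : Cols n) → t ℕ.+ p ≤ n →
                 (∀ (k : Fin p) → G (t ℕ.+ toℕ k) ≋ F (t ℕ.+ toℕ (opposite k))) →
                 (∀ c → Outside t p c → G c ≋ F c) →
                 detᶜ n G ≈ sgn (triangular p) * detᶜ n F
  detᶜ-reverse {n} zero t F G _ _ G-out =
    trans (detᶜ-cong n λ c _ → G-out c (Outside-empty t c)) (sym (*-identityˡ _))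
  detᶜ-reverse {n} (suc p) t F G t+p+1≤n G-rev G-out = begin
    detᶜ n G                                ≈⟨ detᶜ-rotate p t F′ G t+p<n last shift out ⟩
    sgn p * detᶜ n F′                        ≈⟨ *-congˡ (detᶜ-reverse p (suc t) F F′ 1+t+p≤n
                                                  (λ k → ≋-reflexive (splice-inside F (suc t) p _ k))
                                                  (λ c out → ≋-reflexive (splice-outside F (suc t) p _ c out))) ⟩
    sgn p * (sgn (triangular p) * detᶜ n F) ≈⟨ *-assoc _ _ _ ⟨
    sgn p * sgn (triangular p) * detᶜ n F   ≈⟨ *-congʳ (sgn-+ p (triangular p)) ⟨
    sgn (triangular (suc p)) * detᶜ n F     ∎
    where
    F′ : Cols n
    F′ = splice F (suc t) p (λ k → F (suc t ℕ.+ toℕ (opposite k)))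
    t+p<n : t ℕ.+ p < n
    t+p<n = ≡.subst (_≤ n) (ℕₚ.+-suc t p) t+p+1≤n
    1+t+p≤n : suc t ℕ.+ p ≤ n
    1+t+p≤n = ≡.subst (_≤ n) (ℕₚ.+-suc t p) t+p+1≤n
    last : G (t ℕ.+ p) ≋ F′ t
    last = ≋-trans (≋-col G (≡.cong (t ℕ.+_) (≡.sym (toℕ-fromℕ p))))
      (≋-trans (G-rev (fromℕ p))
        (≋-trans (≋-col F (≡.trans (≡.cong (t ℕ.+_) (toℕ-opposite-fromℕ p)) (ℕₚ.+-identityʳ t)))
          (≋-reflexive (≡.sym (splice-outside F (suc t) p _ t (inj₁ (ℕₚ.n<1+n t)))))))
    shift : ∀ (k : Fin p) → G (t ℕ.+ toℕ k) ≋ F′ (suc (t ℕ.+ toℕ k))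
    shift k = ≋-trans (≋-col G (≡.cong (t ℕ.+_) (≡.sym (toℕ-inject₁ k))))
      (≋-trans (G-rev (inject₁ k))
        (≋-trans (≋-col F (≡.trans (≡.cong (t ℕ.+_) (toℕ-opposite-inject₁ k)) (ℕₚ.+-suc t _)))
          (≋-reflexive (≡.sym (splice-inside F (suc t) p _ k)))))
    out : ∀ c → Outside t (suc p) c → G c ≋ F′ c
    out c o = ≋-trans (G-out c o) (≋-reflexive (≡.sym (splice-outside F (suc t) p _ c (Outside-shrink t p c o))))

  -- The column added to the last column of the window may stand anywhere right of it (at c₀).
  detᶜ-stair : ∀ {n} p t c₀ (a : Fin p → Carrier) (Y : ℕ → Col n) (F F′ : Cols n) →
               t ℕ.+ p ≤ c₀ → c₀ < n →
               (∀ (k : Fin p) → F (t ℕ.+ toℕ k) ≋ Y (toℕ k)) → F c₀ ≋ Y p →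
               (∀ k → F′ (t ℕ.+ toℕ k) ≋ a k ·ᶜ Y (toℕ k) +ᶜ Y (suc (toℕ k))) →
               (∀ c → Outside t p c → F′ c ≋ F c) →
               detᶜ n F′ ≈ Πᶠ p a * detᶜ n F
  detᶜ-stair {n} zero t c₀ a Y F F′ _ _ _ _ _ F′-out =
    trans (detᶜ-cong n λ c _ → F′-out c (Outside-empty t c)) (sym (*-identityˡ _))
  detᶜ-stair {n} (suc p) t c₀ a Y F F′ t+p+1≤c₀ c₀<n F-Y F-c₀ F′-step F′-out = begin
    detᶜ n F′                                      ≈⟨ detᶜ-stair p (suc t) c₀ (a ∘ Fin.suc) (Y ∘ suc) G F′
                                                        1+t+p≤c₀ c₀<n G-Y G-c₀ F′-step′ F′-out′ ⟩
    Πᶠ p (a ∘ Fin.suc) * detᶜ n G                  ≈⟨ *-congˡ detᶜG ⟩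
    Πᶠ p (a ∘ Fin.suc) * (a Fin.zero * detᶜ n F)   ≈⟨ x*[y*z]≈y*x*z _ _ _ ⟩
    Πᶠ (suc p) a * detᶜ n F                        ∎
    where
    x*[y*z]≈y*x*z : ∀ x y z → x * (y * z) ≈ y * x * z
    x*[y*z]≈y*x*z = solve 3 (λ x y z → x :* (y :* z) := y :* x :* z) refl
    t<c₀ : t < c₀
    t<c₀ = ℕₚ.<-≤-trans (ℕₚ.m<m+n t (s≤s z≤n)) t+p+1≤c₀
    1+t+p≤c₀ : suc t ℕ.+ p ≤ c₀
    1+t+p≤c₀ = ≡.subst (_≤ c₀) (ℕₚ.+-suc t p) t+p+1≤c₀
    G : Cols n
    G = F [ t ]≔ F′ t
    G-Y : ∀ (k : Fin p) → G (suc t ℕ.+ toℕ k) ≋ Y (suc (toℕ k))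
    G-Y k = ≋-trans (≋-reflexive (update-≢ F (F′ t) (ℕₚ.>⇒≢ (s≤s (ℕₚ.m≤m+n t _)))))
              (≋-trans (≋-col F (≡.sym (ℕₚ.+-suc t (toℕ k)))) (F-Y (Fin.suc k)))
    G-c₀ : G c₀ ≋ Y (suc p)
    G-c₀ = ≋-trans (≋-reflexive (update-≢ F (F′ t) (ℕₚ.>⇒≢ t<c₀))) F-c₀
    F′-step′ : ∀ k → F′ (suc t ℕ.+ toℕ k) ≋ a (Fin.suc k) ·ᶜ Y (suc (toℕ k)) +ᶜ Y (suc (suc (toℕ k)))
    F′-step′ k = ≋-trans (≋-col F′ (≡.sym (ℕₚ.+-suc t (toℕ k)))) (F′-step (Fin.suc k))
    F′-out′ : ∀ c → Outside (suc t) p c → F′ c ≋ G c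
    F′-out′ c out = by-cases (c ℕ.≟ t)
      where
      by-cases : Dec (c ≡ t) → F′ c ≋ G c
      by-cases (yes ≡.refl) = ≋-reflexive (≡.sym (update-≡ F c (F′ c)))
      by-cases (no c≢t) = ≋-trans (F′-out c (Outside-grow t p c c≢t out)) (≋-reflexive (≡.sym (update-≢ F (F′ t) c≢t)))
    Y₁-column : ∀ p → t ℕ.+ suc p ≤ c₀ → (∀ (k : Fin (suc p)) → F (t ℕ.+ toℕ k) ≋ Y (toℕ k)) → F c₀ ≋ Y (suc p) →
                Σ[ c₁ ∈ ℕ ] t < c₁ × c₁ < n × F c₁ ≋ Y 1
    Y₁-column zero    _         _   F-c₀ = c₀ , t<c₀ , c₀<n , F-c₀
    Y₁-column (suc p) t+p+2≤c₀ F-Y _    =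
      suc t , ℕₚ.n<1+n t ,
      ℕₚ.<-trans (ℕₚ.<-≤-trans (≡.subst (suc t <_) (≡.sym (ℕₚ.+-suc t (suc p))) (s≤s (ℕₚ.m<m+n t (s≤s z≤n)))) t+p+2≤c₀) c₀<n ,
      ≋-trans (≋-col F (ℕₚ.+-comm 1 t)) (F-Y (Fin.suc Fin.zero))
    detᶜG : detᶜ n G ≈ a Fin.zero * detᶜ n F
    detᶜG with Y₁-column p t+p+1≤c₀ F-Y F-c₀
    ... | c₁ , t<c₁ , c₁<n , Fc₁≋Y₁ =
      detᶜ-scale-add (a Fin.zero) F G t<c₁ c₁<n G-t (λ k k≢t → ≋-reflexive (update-≢ F (F′ t) k≢t))
      where
      t+0≡t : t ℕ.+ toℕ (Fin.zero {p}) ≡ t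
      t+0≡t = ℕₚ.+-identityʳ t
      G-t : G t ≋ a Fin.zero ·ᶜ F t +ᶜ F c₁
      G-t = ≋-trans (≋-reflexive (update-≡ F t (F′ t)))
              (≋-trans (≋-col F′ (≡.sym t+0≡t))
                (≋-trans (F′-step Fin.zero) λ i → +-cong
                  (*-congˡ (sym (≋-trans (≋-col F (≡.sym t+0≡t)) (F-Y Fin.zero) i)))
                  (sym (Fc₁≋Y₁ i))))

  -- Complete homogeneous symmetric polynomials

  hℕ-swap : ∀ n a b zs → hℕ n (a ∷ b ∷ zs) ≈ hℕ n (b ∷ a ∷ zs)
  hℕ-swap zero          a b zs = refl
  hℕ-swap (suc zero)    a b zs = solve 4 (λ z a b e → z :+ b :* e :+ a :* e := z :+ a :* e :+ b :* e) refl _ a b 1#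
  hℕ-swap (suc (suc n)) a b zs = begin
    hℕ (2 ℕ.+ n) zs + b * P + a * K            ≈⟨ +-assoc _ _ _ ⟩
    hℕ (2 ℕ.+ n) zs + (b * P + a * K)          ≈⟨ +-congˡ (+-cancelʳ (a * b * hℕ n (a ∷ b ∷ zs)) _ _ (begin
      b * P + a * K + a * b * hℕ n (a ∷ b ∷ zs)   ≈⟨ expand a b P (hℕ n (a ∷ b ∷ zs)) ⟩
      (a + b) * K                                 ≈⟨ *-cong (+-comm a b) (hℕ-swap (suc n) a b zs) ⟩
      (b + a) * K′                                ≈⟨ expand b a Q (hℕ n (b ∷ a ∷ zs)) ⟨
      a * Q + b * K′ + b * a * hℕ n (b ∷ a ∷ zs)  ≈⟨ +-congˡ (*-cong (*-comm a b) (hℕ-swap n a b zs)) ⟨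
      a * Q + b * K′ + a * b * hℕ n (a ∷ b ∷ zs)  ∎)) ⟩
    hℕ (2 ℕ.+ n) zs + (a * Q + b * K′)         ≈⟨ +-assoc _ _ _ ⟨
    hℕ (2 ℕ.+ n) zs + a * Q + b * K′           ∎
    where
    P = hℕ (suc n) (b ∷ zs)
    Q = hℕ (suc n) (a ∷ zs)
    K = hℕ (suc n) (a ∷ b ∷ zs)
    K′ = hℕ (suc n) (b ∷ a ∷ zs)
    -- K = P + a·hₙ(a ∷ b ∷ zs), so both sides equal (a + b)·K up to the symmetric term a·b·hₙ.
    expand : ∀ a b p k → b * p + a * (p + a * k) + a * b * k ≈ (a + b) * (p + a * k)
    expand = solve 4 (λ a b p k → b :* p :+ a :* (p :+ a :* k) :+ a :* b :* k := (a :+ b) :* (p :+ a :* k)) refl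

  hℕ-∷-cong : ∀ x {xs ys} → (∀ n → hℕ n xs ≈ hℕ n ys) → ∀ n → hℕ n (x ∷ xs) ≈ hℕ n (x ∷ ys)
  hℕ-∷-cong x xs≈ys zero    = refl
  hℕ-∷-cong x xs≈ys (suc n) = +-cong (xs≈ys (suc n)) (*-congˡ (hℕ-∷-cong x xs≈ys n))

  hℕ-++-∷ : ∀ xs y ys n → hℕ n (xs ++ y ∷ ys) ≈ hℕ n (y ∷ xs ++ ys)
  hℕ-++-∷ []       y ys n = refl
  hℕ-++-∷ (x ∷ xs) y ys n = trans (hℕ-∷-cong x (hℕ-++-∷ xs y ys) n) (hℕ-swap n x y (xs ++ ys))

  -- Expand h_{d+1}(x ∷ Z ++ y ∷ Y) at x and, after moving y to the front, at y.
  h-exchange : ∀ d x Z y Y → h (ℤ.suc d) (x ∷ Z ++ Y) ≈ (x - y) * h d (x ∷ Z ++ y ∷ Y) + h (ℤ.suc d) (Z ++ y ∷ Y)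
  h-exchange (+ n) x Z y Y = +-cancelʳ (y * E) _ _ (begin
    A + y * E                   ≈⟨ +-congˡ (*-congˡ (hℕ-++-∷ (x ∷ Z) y Y n)) ⟩
    A + y * hℕ n (y ∷ x ∷ Z ++ Y) ≈⟨ hℕ-++-∷ (x ∷ Z) y Y (suc n) ⟨
    B + x * E                   ≈⟨ +-congˡ (*-congʳ x≈x-y+y) ⟩
    B + (x - y + y) * E         ≈⟨ rearrange B (x - y) y E ⟩
    (x - y) * E + B + y * E     ∎)
    where
    E = hℕ n (x ∷ Z ++ y ∷ Y)
    A = hℕ (suc n) (x ∷ Z ++ Y)
    B = hℕ (suc n) (Z ++ y ∷ Y)
    x≈x-y+y : x ≈ x - y + y
    x≈x-y+y = begin
      x            ≈⟨ +-identityʳ x ⟨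
      x + 0#       ≈⟨ +-congˡ (-‿inverseˡ y) ⟨
      x + (- y + y) ≈⟨ +-assoc x (- y) y ⟨
      x - y + y    ∎
    rearrange : ∀ b w y e → b + (w + y) * e ≈ w * e + b + y * e
    rearrange = solve 4 (λ b w y e → b :+ (w :+ y) :* e := w :* e :+ b :+ y :* e) refl
  h-exchange -[1+ zero  ] x Z y Y = sym (trans (+-congʳ (zeroʳ _)) (+-identityˡ _))
  h-exchange -[1+ suc n ] x Z y Y = sym (trans (+-congʳ (zeroʳ _)) (+-identityˡ _))

  module Columns {N : ℕ} (la : Fin N → ℕ) where

    Hᶜ : ℕ → List Carrier → Col N
    Hᶜ s xs = H (+ s) la xs

    Hᶜ-cong : ∀ {s s′ xs ys} → s ≡ s′ → xs ≡ ys → Hᶜ s xs ≋ Hᶜ s′ ys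
    Hᶜ-cong s≡s′ xs≡ys = ≋-reflexive (≡.cong₂ Hᶜ s≡s′ xs≡ys)

    Hᶜ-exchange : ∀ d x Z y Y → Hᶜ (suc d) (x ∷ Z ++ Y) ≋ (x - y) ·ᶜ Hᶜ d (x ∷ Z ++ y ∷ Y) +ᶜ Hᶜ (suc d) (Z ++ y ∷ Y)
    Hᶜ-exchange d x Z y Y i rewrite +[1+d]+l-j≡suc[+d+l-j] d (la i) (suc (toℕ i)) =
      h-exchange (+ d ℤ.+ + la i ℤ.- + suc (toℕ i)) x Z y Y

    -- Removing y from the lists of the window columns turns them into a stair of
    -- column operations (Hᶜ-exchange), the last one adding H_{s+p+1}(y ∷ V).
    elimination-step : ∀ {p} (u : Fin p → Carrier) y V s t c₀ (F : Cols N) → t ℕ.+ p ≤ c₀ → c₀ < N →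
      (∀ (k : Fin p) → F (t ℕ.+ toℕ k) ≋ Hᶜ (s ℕ.+ suc (toℕ k)) (drop (toℕ k) (toList u) ++ y ∷ V)) →
      F c₀ ≋ Hᶜ (s ℕ.+ suc p) (y ∷ V) →
      detᶜ N (splice F t p λ k → Hᶜ (suc s ℕ.+ suc (toℕ k)) (drop (toℕ k) (toList u) ++ V)) ≈
      Πᶠ p (λ k → u k - y) * detᶜ N F
    elimination-step {p} u y V s t c₀ F t+p≤c₀ c₀<N F-u F-c₀ =
      detᶜ-stair p t c₀ (λ k → u k - y) Y F _ t+p≤c₀ c₀<N F-u
        (≋-trans F-c₀ (Hᶜ-cong {s = s ℕ.+ suc p} ≡.refl (≡.cong (_++ y ∷ V) (≡.sym (drop-toList-all p u)))))
        step (λ c out → ≋-reflexive (splice-outside F t p W c out))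
      where
      Y : ℕ → Col N
      Y k = Hᶜ (s ℕ.+ suc k) (drop k (toList u) ++ y ∷ V)
      W : Fin p → Col N
      W k = Hᶜ (suc s ℕ.+ suc (toℕ k)) (drop (toℕ k) (toList u) ++ V)
      step : ∀ k → splice F t p W (t ℕ.+ toℕ k) ≋ (u k - y) ·ᶜ Y (toℕ k) +ᶜ Y (suc (toℕ k))
      step k = ≋-trans (≋-reflexive (splice-inside F t p W k))
        (≋-trans (Hᶜ-cong {s = suc s ℕ.+ suc (toℕ k)} ≡.refl (≡.cong (_++ V) (drop-toList u k)))
          (≋-trans (Hᶜ-exchange (s ℕ.+ suc (toℕ k)) (u k) (drop (suc (toℕ k)) (toList u)) y V)
            λ i → +-cong (*-congˡ (Hᶜ-cong {s = s ℕ.+ suc (toℕ k)} ≡.refl (≡.cong (_++ y ∷ V) (≡.sym (drop-toList u k))) i))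
                         (Hᶜ-cong (≡.sym (ℕₚ.+-suc s (suc (toℕ k)))) ≡.refl i)))

    -- The variables v are removed one at a time; the column right of the window
    -- is then always the first remaining v-column, b columns after the window.
    eliminate : ∀ {p} (u : Fin p → Carrier) q (v : Fin q → Carrier) s b t (F G : Cols N) →
      t ℕ.+ p ℕ.+ b ℕ.+ q ≤ N →
      (∀ (k : Fin p) → F (t ℕ.+ toℕ k) ≋ Hᶜ (s ℕ.+ suc (toℕ k)) (drop (toℕ k) (toList u) ++ toList v)) →
      (∀ (r : Fin q) → F (t ℕ.+ p ℕ.+ b ℕ.+ toℕ r) ≋ Hᶜ (s ℕ.+ p ℕ.+ suc (toℕ r)) (drop (toℕ r) (toList v))) →
      (∀ (k : Fin p) → G (t ℕ.+ toℕ k) ≋ Hᶜ (s ℕ.+ q ℕ.+ suc (toℕ k)) (drop (toℕ k) (toList u))) →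
      (∀ c → Outside t p c → G c ≋ F c) →
      Πᶠ q (λ r → Πᶠ p (λ k → u k - v r)) * detᶜ N F ≈ detᶜ N G
    eliminate {p} u zero v s b t F G _ F-u _ G-u G-out = trans (*-identityˡ _) (detᶜ-cong N F≋G)
      where
      F≋G : ∀ c → c < N → F c ≋ G c
      F≋G c _ with position t p c
      ... | before c<t = ≋-sym (G-out c (inj₁ c<t))
      ... | inside k ≡.refl = ≋-trans (F-u k) (≋-trans
              (Hᶜ-cong (≡.cong (ℕ._+ suc (toℕ k)) (≡.sym (ℕₚ.+-identityʳ s))) (++-identityʳ _)) (≋-sym (G-u k)))
      ... | after t+p≤c = ≋-sym (G-out c (inj₂ t+p≤c))
    eliminate {p} u (suc q) v s b t F G t+p+b+q+1≤N F-u F-v G-u G-out = begin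
      Πᶠ p (λ k → u k - v₀) * Πᶠ q rest * detᶜ N F   ≈⟨ x*y*z≈y*[x*z] _ _ _ ⟩
      Πᶠ q rest * (Πᶠ p (λ k → u k - v₀) * detᶜ N F) ≈⟨ *-congˡ (elimination-step u v₀ V′ s t (t ℕ.+ p ℕ.+ b) F
                                                           (ℕₚ.m≤m+n (t ℕ.+ p) b) c₀<N F-u F-c₀) ⟨
      Πᶠ q rest * detᶜ N F′                          ≈⟨ eliminate u q (v ∘ Fin.suc) (suc s) (suc b) t F′ G bound
                                                           F′-u F′-v G-u′ G-out′ ⟩
      detᶜ N G                                       ∎
      where
      x*y*z≈y*[x*z] : ∀ x y z → x * y * z ≈ y * (x * z)
      x*y*z≈y*[x*z] = solve 3 (λ x y z → x :* y :* z := y :* (x :* z)) refl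
      v₀ = v Fin.zero
      V′ = toList (v ∘ Fin.suc)
      rest : Fin q → Carrier
      rest r = Πᶠ p (λ k → u k - v (Fin.suc r))
      W : Fin p → Col N
      W k = Hᶜ (suc s ℕ.+ suc (toℕ k)) (drop (toℕ k) (toList u) ++ V′)
      F′ : Cols N
      F′ = splice F t p W
      c₀<N : t ℕ.+ p ℕ.+ b < N
      c₀<N = ℕₚ.<-≤-trans (ℕₚ.m<m+n _ (s≤s z≤n)) t+p+b+q+1≤N
      F-c₀ : F (t ℕ.+ p ℕ.+ b) ≋ Hᶜ (s ℕ.+ suc p) (toList v)
      F-c₀ = ≋-trans (≋-col F (≡.sym (ℕₚ.+-identityʳ _)))
               (≋-trans (F-v Fin.zero) (Hᶜ-cong (≡.trans (ℕₚ.+-assoc s p 1) (≡.cong (s ℕ.+_) (ℕₚ.+-comm p 1))) ≡.refl))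
      bound : t ℕ.+ p ℕ.+ suc b ℕ.+ q ≤ N
      bound = ≡.subst (_≤ N) (≡.sym (m+1+n+o≡m+n+1+o (t ℕ.+ p) b q)) t+p+b+q+1≤N
      F′-u : ∀ (k : Fin p) → F′ (t ℕ.+ toℕ k) ≋ W k
      F′-u k = ≋-reflexive (splice-inside F t p W k)
      F′-out : ∀ c → Outside t p c → F′ c ≋ F c
      F′-out c out = ≋-reflexive (splice-outside F t p W c out)
      F′-v : ∀ (r : Fin q) → F′ (t ℕ.+ p ℕ.+ suc b ℕ.+ toℕ r) ≋ Hᶜ (suc s ℕ.+ p ℕ.+ suc (toℕ r)) (drop (toℕ r) V′)
      F′-v r = ≋-trans (F′-out _ (inj₂ (ℕₚ.≤-trans (ℕₚ.m≤m+n (t ℕ.+ p) (suc b)) (ℕₚ.m≤m+n _ (toℕ r)))))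
        (≋-trans (≋-col F (m+1+n+o≡m+n+1+o (t ℕ.+ p) b (toℕ r)))
          (≋-trans (F-v (Fin.suc r)) (Hᶜ-cong (ℕₚ.+-suc (s ℕ.+ p) (suc (toℕ r))) ≡.refl)))
      G-u′ : ∀ (k : Fin p) → G (t ℕ.+ toℕ k) ≋ Hᶜ (suc s ℕ.+ q ℕ.+ suc (toℕ k)) (drop (toℕ k) (toList u))
      G-u′ k = ≋-trans (G-u k) (Hᶜ-cong (≡.cong (ℕ._+ suc (toℕ k)) (ℕₚ.+-suc s q)) ≡.refl)
      G-out′ : ∀ c → Outside t p c → G c ≋ F′ c
      G-out′ c out = ≋-trans (G-out c out) (≋-sym (F′-out c out))

  blockCols : ∀ N t p → (Fin N → Fin t → Carrier) → (ℕ → Col N) → (ℕ → Col N) → Cols N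
  blockCols N t p A uc vc c i with c ℕ.<? t
  ... | yes c<t = A i (fromℕ< c<t)
  ... | no _ with c ∸ t ℕ.<? p
  ...   | yes _ = uc (c ∸ t) i
  ...   | no _  = vc (c ∸ t ∸ p) i

  det-blockMat : ∀ N t p A uc vc → det N (blockMat N t p A uc vc) ≈ detᶜ N (blockCols N t p A uc vc)
  det-blockMat N t p A uc vc = det-cong N λ i c → reflexive (blockMat≡blockCols i c)
    where
    blockMat≡blockCols : ∀ i c → blockMat N t p A uc vc i c ≡ blockCols N t p A uc vc (toℕ c) i
    blockMat≡blockCols i c with toℕ c ℕ.<? t
    ... | yes _ = ≡.refl
    ... | no _ with toℕ c ∸ t ℕ.<? p
    ...   | yes _ = ≡.refl
    ...   | no _  = ≡.refl

  blockCols-u : ∀ N t p A uc vc (k : Fin p) → blockCols N t p A uc vc (t ℕ.+ toℕ k) ≋ uc (toℕ k)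
  blockCols-u N t p A uc vc k i with t ℕ.+ toℕ k ℕ.<? t
  ... | yes t+k<t = ⊥-elim (inside⇒¬Outside t p k (inj₁ t+k<t))
  ... | no _ with t ℕ.+ toℕ k ∸ t ℕ.<? p
  ...   | yes _ = reflexive (≡.cong (λ m → uc m i) (ℕₚ.m+n∸m≡n t (toℕ k)))
  ...   | no k≮p = ⊥-elim (k≮p (≡.subst (_< p) (≡.sym (ℕₚ.m+n∸m≡n t (toℕ k))) (toℕ<n k)))

  blockCols-v : ∀ N t p A uc vc r → blockCols N t p A uc vc (t ℕ.+ p ℕ.+ r) ≋ vc r
  blockCols-v N t p A uc vc r i with t ℕ.+ p ℕ.+ r ℕ.<? t
  ... | yes t+p+r<t = ⊥-elim (ℕₚ.m+n≮m t (p ℕ.+ r) (≡.subst (_< t) (ℕₚ.+-assoc t p r) t+p+r<t))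
  ... | no _ with t ℕ.+ p ℕ.+ r ∸ t ℕ.<? p
  ...   | yes p+r<p = ⊥-elim (ℕₚ.m+n≮m p r (≡.subst (_< p) (m+n+o∸m≡n+o t p r) p+r<p))
  ...   | no _ = reflexive (≡.cong (λ m → vc m i) (≡.trans (≡.cong (_∸ p) (m+n+o∸m≡n+o t p r)) (ℕₚ.m+n∸m≡n p r)))

  blockCols-outside : ∀ N t p A uc uc′ vc c → Outside t p c → blockCols N t p A uc vc c ≋ blockCols N t p A uc′ vc c
  blockCols-outside N t p A uc uc′ vc c out i with c ℕ.<? t
  ... | yes _ = refl
  ... | no c≮t with c ∸ t ℕ.<? p
  ...   | no _ = refl
  ...   | yes c∸t<p with out
  ...     | inj₁ c<t = ⊥-elim (c≮t c<t)
  ...     | inj₂ t+p≤c = ⊥-elim (ℕₚ.<⇒≱ c∸t<p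
              (ℕₚ.+-cancelˡ-≤ t _ _ (≡.subst (t ℕ.+ p ≤_) (≡.sym (ℕₚ.m+[n∸m]≡n (ℕₚ.≮⇒≥ c≮t))) t+p≤c)))

  module _ (N p q : ℕ) (la : Fin N → ℕ) (A : Fin N → Fin (N ∸ p ∸ q) → Carrier)
           (u : Fin p → Carrier) (v : Fin q → Carrier) (p+q≤N : p ℕ.+ q ≤ N) where
    open Lemma7p2 N p q la u v
    open Columns la

    t+p+q≡N : t ℕ.+ p ℕ.+ q ≡ N
    t+p+q≡N = N∸p∸q+p+q≡N N p q p+q≤N

    D*P≈D₁ : D A * P ≈ D₁ A
    D*P≈D₁ = begin
      D A * P                                                    ≈⟨ *-comm (D A) P ⟩
      P * D A                                                    ≈⟨ *-cong (Πᶠ-comm p q (λ j k → u j - v k))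
                                                                           (det-blockMat N t p A uColD vCol) ⟩
      Πᶠ q (λ r → Πᶠ p (λ k → u k - v r)) * detᶜ N (blockCols N t p A uColD vCol)
        ≈⟨ eliminate u q v t 0 t _ _ (ℕₚ.≤-reflexive (≡.trans (≡.cong (ℕ._+ q) (ℕₚ.+-identityʳ _)) t+p+q≡N))
             (blockCols-u N t p A uColD vCol)
             (λ r → ≋-trans (≋-col (blockCols N t p A uColD vCol) (≡.cong (ℕ._+ toℕ r) (ℕₚ.+-identityʳ _)))
                            (blockCols-v N t p A uColD vCol (toℕ r)))
             (blockCols-u N t p A uColD₁ vCol)
             (blockCols-outside N t p A uColD₁ uColD vCol) ⟩
      detᶜ N (blockCols N t p A uColD₁ vCol)                     ≈⟨ det-blockMat N t p A uColD₁ vCol ⟨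
      D₁ A                                                       ∎

    uColD₂≡uColD₁∘opposite : ∀ (k : Fin p) → uColD₂ (toℕ k) ≡ uColD₁ (toℕ (opposite k))
    uColD₂≡uColD₁∘opposite k rewrite opposite-prop k =
      ≡.cong (λ m → H (+ (t ℕ.+ q ℕ.+ m)) la (drop (p ∸ suc (toℕ k)) us)) (ℕₚ.+-∸-assoc 1 (toℕ<n k))

    D₂≈sgn*D₁ : D₂ A ≈ sgn (triangular p) * D₁ A
    D₂≈sgn*D₁ = begin
      D₂ A                                                       ≈⟨ det-blockMat N t p A uColD₂ vCol ⟩
      detᶜ N (blockCols N t p A uColD₂ vCol)
        ≈⟨ detᶜ-reverse p t _ _ (ℕₚ.≤-trans (ℕₚ.m≤m+n (t ℕ.+ p) q) (ℕₚ.≤-reflexive t+p+q≡N))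
             (λ k → ≋-trans (blockCols-u N t p A uColD₂ vCol k)
                      (≋-trans (≋-reflexive (uColD₂≡uColD₁∘opposite k))
                               (≋-sym (blockCols-u N t p A uColD₁ vCol (opposite k)))))
             (blockCols-outside N t p A uColD₂ uColD₁ vCol) ⟩
      sgn (triangular p) * detᶜ N (blockCols N t p A uColD₁ vCol) ≈⟨ *-congˡ (det-blockMat N t p A uColD₁ vCol) ⟨
      sgn (triangular p) * D₁ A                                   ∎

    D*[sgn*P]≈D₂ : D A * (sgn ((p ℕ.* (p ∸ 1)) ℕ./ 2) * P) ≈ D₂ A
    D*[sgn*P]≈D₂ = begin
      D A * (sgn ((p ℕ.* (p ∸ 1)) ℕ./ 2) * P) ≈⟨ x*[y*z]≈y*[x*z] (D A) _ P ⟩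
      sgn ((p ℕ.* (p ∸ 1)) ℕ./ 2) * (D A * P) ≈⟨ *-cong (reflexive (≡.cong sgn (p*[p∸1]/2≡triangular p))) D*P≈D₁ ⟩
      sgn (triangular p) * D₁ A               ≈⟨ D₂≈sgn*D₁ ⟨
      D₂ A                                    ∎
      where
      x*[y*z]≈y*[x*z] : ∀ x y z → x * (y * z) ≈ y * (x * z)
      x*[y*z]≈y*[x*z] = solve 3 (λ x y z → x :* (y :* z) := y :* (x :* z)) refl

-- The identity is multiplicative.
lemma7p2 : ∀ {c ℓ : Level} (F : Field c ℓ) →
  let R = Field.commutativeRing F
      open CommutativeRing R
      open Ops R
  in (N p q : ℕ) → p ℕ.+ q ≤ N →
     (la : Fin N → ℕ) → IsPartition la →
     (A : Fin N → Fin (N ∸ p ∸ q) → Carrier) →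
     (u : Fin p → Carrier) (v : Fin q → Carrier) →
     (∀ (j : Fin p) (k : Fin q) → ¬ (u j ≈ v k)) →
     let open Lemma7p2 N p q la u v
     in (D A * P ≈ D₁ A) × (D A * (sgn ((p ℕ.* (p ∸ 1)) ℕ./ 2) * P) ≈ D₂ A)
lemma7p2 F N p q p+q≤N la _ A u v _ =
  D*P≈D₁ R N p q la A u v p+q≤N , D*[sgn*P]≈D₂ R N p q la A u v p+q≤N
  where
  R = Field.commutativeRing F
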